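{- There exists an antipodal $3$-splitting of $Q_2^4$, and there exists an antipodal $5$-splitting of $Q_2^8$.
   Context: $Q_2^n=\{0,1\}^n$. An $m$-face of $Q_2^n$ is given by a tuple $(a_1,\dots,a_n)\in\{0,1,*\}^n$ with exactly $m$ entries equal to $*$; it is the set $\{x\in Q_2^n : x_i=a_i \text{ whenever } a_i\in\{0,1\}\}$. Its direction is the set of positions $i$ with $a_i=*$. Two faces are parallel if they have the same direction; two parallel faces $a,b$ are antipodal if $b_i=1-a_i$ for every $i$ with $a_i\neq *$. An antipodal $k$-splitting of $Q_2^n$ is a collection of exactly $2^k$ faces of dimension $n-k$ whose union is $Q_2^n$ and which contains no two distinct parallel faces that are not antipodal. -}

module Defs where

open import Data.Nat using (ℕ; zero; suc; _+_; _∸_; _^_)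
open import Data.Bool using (Bool; true; false)
open import Data.Fin using (Fin)
open import Data.Vec using (Vec; []; _∷_; map)
open import Data.Vec.Relation.Binary.Pointwise.Inductive using (Pointwise)
open import Data.Product using (∃; _×_)
open import Relation.Binary.PropositionalEquality using (_≡_; _≢_)
open import Function.Definitions using (Injective)

data Sym : Set where
  s0 s1 ⋆ : Sym

-- A face of Q_2^n is a tuple in {0,1,*}^n.
Face : ℕ → Set
Face n = Vec Sym n

Vertex : ℕ → Set
Vertex n = Vec Bool n

dim : ∀ {n} → Face n → ℕ
dim [] = 0
dim (⋆ ∷ a) = suc (dim a)
dim (s0 ∷ a) = dim a
dim (s1 ∷ a) = dim a

data Match : Bool → Sym → Set where
  m0 : Match false s0
  m1 : Match true s1
  m⋆ : ∀ {b} → Match b ⋆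

_∈F_ : ∀ {n} → Vertex n → Face n → Set
x ∈F a = Pointwise Match x a

isStar : Sym → Bool
isStar ⋆ = true
isStar s0 = false
isStar s1 = false

direction : ∀ {n} → Face n → Vec Bool n
direction = map isStar

Parallel : ∀ {n} → Face n → Face n → Set
Parallel a b = direction a ≡ direction b

data Opp : Sym → Sym → Set where
  o01 : Opp s0 s1
  o10 : Opp s1 s0
  o⋆ : Opp ⋆ ⋆

Antipodal : ∀ {n} → Face n → Face n → Set
Antipodal a b = Parallel a b × Pointwise Opp a b

record AntipodalSplitting (n k : ℕ) : Set where
  field
    face      : Fin (2 ^ k) → Face n
    distinct  : Injective _≡_ _≡_ face
    dimension : ∀ i → dim (face i) ≡ n ∸ k
    covers    : ∀ (x : Vertex n) → ∃ λ i → x ∈F face i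
    antipodal : ∀ i j → face i ≢ face j → Parallel (face i) (face j)
                → Antipodal (face i) (face j)

-- Both splittings are exhibited explicitly as lists of faces. Every condition
-- in the definition of an antipodal splitting quantifies only over finite
-- sets (indices of faces and vertices of the cube) and is decidable, so a
-- candidate list is verified by evaluating the decision procedures.
module Submission where

open import Defs
open import Data.Bool using (Bool; true; false)
import Data.Bool.Properties as Bool
open import Data.Fin using (Fin)
import Data.Fin.Properties as Fin
open import Data.Nat using (ℕ; zero; suc; _∸_; _^_)
import Data.Nat.Properties as ℕ
open import Data.Product using (_×_; _,_; ∃)
open import Data.Vec using (Vec; []; _∷_; lookup)
import Data.Vec.Properties as Vec
open import Data.Vec.Relation.Binary.Pointwise.Inductive using (decidable)
open import Relation.Binary.Definitions using (DecidableEquality)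
open import Relation.Binary.PropositionalEquality using (_≡_; _≢_; refl)
open import Relation.Nullary using (Dec; yes; no; ¬?)
open import Relation.Nullary.Decidable using (True; toWitness; _×-dec_; _→-dec_)

_≟ₛ_ : DecidableEquality Sym
s0 ≟ₛ s0 = yes refl
s1 ≟ₛ s1 = yes refl
⋆  ≟ₛ ⋆  = yes refl
s0 ≟ₛ s1 = no λ ()
s0 ≟ₛ ⋆  = no λ ()
s1 ≟ₛ s0 = no λ ()
s1 ≟ₛ ⋆  = no λ ()
⋆  ≟ₛ s0 = no λ ()
⋆  ≟ₛ s1 = no λ ()

match? : (b : Bool) (s : Sym) → Dec (Match b s)
match? false s0 = yes m0
match? true  s1 = yes m1
match? _     ⋆  = yes m⋆
match? false s1 = no λ ()
match? true  s0 = no λ ()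

opp? : (a b : Sym) → Dec (Opp a b)
opp? s0 s1 = yes o01
opp? s1 s0 = yes o10
opp? ⋆  ⋆  = yes o⋆
opp? s0 s0 = no λ ()
opp? s0 ⋆  = no λ ()
opp? s1 s1 = no λ ()
opp? s1 ⋆  = no λ ()
opp? ⋆  s0 = no λ ()
opp? ⋆  s1 = no λ ()

∀-vertex? : ∀ n {P : Vertex n → Set} → (∀ x → Dec (P x)) → Dec (∀ x → P x)
∀-vertex? zero P? with P? []
... | yes p = yes λ { [] → p }
... | no ¬p = no λ ∀P → ¬p (∀P [])
∀-vertex? (suc n) P?
  with ∀-vertex? n (λ x → P? (false ∷ x)) | ∀-vertex? n (λ x → P? (true ∷ x))
... | yes p₀ | yes p₁ = yes λ { (false ∷ x) → p₀ x ; (true ∷ x) → p₁ x }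
... | no ¬p₀ | _      = no λ ∀P → ¬p₀ (λ x → ∀P (false ∷ x))
... | yes _  | no ¬p₁ = no λ ∀P → ¬p₁ (λ x → ∀P (true ∷ x))

module _ {n : ℕ} where

  _≟F_ : DecidableEquality (Face n)
  _≟F_ = Vec.≡-dec _≟ₛ_

  _∈F?_ : (x : Vertex n) (a : Face n) → Dec (x ∈F a)
  _∈F?_ = decidable match?

  parallel? : (a b : Face n) → Dec (Parallel a b)
  parallel? a b = Vec.≡-dec Bool._≟_ (direction a) (direction b)

  antipodal? : (a b : Face n) → Dec (Antipodal a b)
  antipodal? a b = parallel? a b ×-dec decidable opp? a b

module _ {n k : ℕ} (face : Fin (2 ^ k) → Face n) where

  SplittingConditions : Set
  SplittingConditions =
    (∀ i j → face i ≡ face j → i ≡ j) ×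
    (∀ i → dim (face i) ≡ n ∸ k) ×
    (∀ (x : Vertex n) → ∃ λ i → x ∈F face i) ×
    (∀ i j → face i ≢ face j → Parallel (face i) (face j)
           → Antipodal (face i) (face j))

  splittingConditions? : Dec SplittingConditions
  splittingConditions? =
    Fin.all? (λ i → Fin.all? λ j → face i ≟F face j →-dec i Fin.≟ j) ×-dec
    Fin.all? (λ i → dim (face i) ℕ.≟ n ∸ k) ×-dec
    ∀-vertex? n (λ x → Fin.any? λ i → x ∈F? face i) ×-dec
    Fin.all? (λ i → Fin.all? λ j →
      ¬? (face i ≟F face j) →-dec
      (parallel? (face i) (face j) →-dec antipodal? (face i) (face j)))

  toSplitting : SplittingConditions → AntipodalSplitting n k
  toSplitting (distinct , dimension , covers , antipodal) = record
    { face      = face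
    ; distinct  = λ {i} {j} → distinct i j
    ; dimension = dimension
    ; covers    = covers
    ; antipodal = antipodal
    }

fromFaces : ∀ {n} k (faces : Vec (Face n) (2 ^ k)) →
            True (splittingConditions? {k = k} (lookup faces)) → AntipodalSplitting n k
fromFaces k faces valid = toSplitting {k = k} (lookup faces) (toWitness valid)

faces₄₃ : Vec (Face 4) 8
faces₄₃ =
  (s0 ∷ s0 ∷ ⋆ ∷ s0 ∷ [])
  ∷ (s1 ∷ ⋆ ∷ s0 ∷ s0 ∷ [])
  ∷ (s0 ∷ s1 ∷ s0 ∷ ⋆ ∷ [])
  ∷ (s1 ∷ s0 ∷ s1 ∷ ⋆ ∷ [])
  ∷ (⋆ ∷ s1 ∷ s1 ∷ s0 ∷ [])
  ∷ (⋆ ∷ s0 ∷ s0 ∷ s1 ∷ [])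
  ∷ (s1 ∷ s1 ∷ ⋆ ∷ s1 ∷ [])
  ∷ (s0 ∷ ⋆ ∷ s1 ∷ s1 ∷ [])
  ∷ []

faces₈₅ : Vec (Face 8) 32
faces₈₅ =
  (⋆ ∷ s1 ∷ ⋆ ∷ s1 ∷ s0 ∷ ⋆ ∷ s1 ∷ s0 ∷ [])
  ∷ (⋆ ∷ s0 ∷ s0 ∷ s1 ∷ ⋆ ∷ s1 ∷ ⋆ ∷ s0 ∷ [])
  ∷ (⋆ ∷ s0 ∷ ⋆ ∷ ⋆ ∷ s0 ∷ s0 ∷ s1 ∷ s0 ∷ [])
  ∷ (⋆ ∷ s0 ∷ s1 ∷ ⋆ ∷ s0 ∷ s1 ∷ ⋆ ∷ s0 ∷ [])
  ∷ (s1 ∷ ⋆ ∷ s0 ∷ s0 ∷ s0 ∷ s1 ∷ ⋆ ∷ ⋆ ∷ [])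
  ∷ (s0 ∷ ⋆ ∷ s0 ∷ s0 ∷ ⋆ ∷ s1 ∷ s1 ∷ ⋆ ∷ [])
  ∷ (s0 ∷ ⋆ ∷ s0 ∷ s0 ∷ s0 ∷ ⋆ ∷ s0 ∷ ⋆ ∷ [])
  ∷ (⋆ ∷ s1 ∷ ⋆ ∷ s0 ∷ ⋆ ∷ s0 ∷ s1 ∷ s0 ∷ [])
  ∷ (⋆ ∷ s1 ∷ s1 ∷ s0 ∷ s0 ∷ s1 ∷ ⋆ ∷ ⋆ ∷ [])
  ∷ (s1 ∷ ⋆ ∷ ⋆ ∷ s0 ∷ s1 ∷ s1 ∷ s1 ∷ ⋆ ∷ [])
  ∷ (s0 ∷ ⋆ ∷ s1 ∷ ⋆ ∷ s1 ∷ s1 ∷ s1 ∷ ⋆ ∷ [])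
  ∷ (⋆ ∷ s1 ∷ s0 ∷ s1 ∷ s1 ∷ ⋆ ∷ ⋆ ∷ s0 ∷ [])
  ∷ (s1 ∷ ⋆ ∷ s1 ∷ s1 ∷ s1 ∷ ⋆ ∷ s1 ∷ ⋆ ∷ [])
  ∷ (s0 ∷ ⋆ ∷ s1 ∷ s1 ∷ s1 ∷ s0 ∷ ⋆ ∷ ⋆ ∷ [])
  ∷ (⋆ ∷ s0 ∷ s0 ∷ s1 ∷ s1 ∷ s0 ∷ ⋆ ∷ ⋆ ∷ [])
  ∷ (⋆ ∷ s1 ∷ ⋆ ∷ s1 ∷ s0 ∷ s1 ∷ s0 ∷ ⋆ ∷ [])
  ∷ (⋆ ∷ ⋆ ∷ s0 ∷ s1 ∷ ⋆ ∷ s1 ∷ s1 ∷ s1 ∷ [])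
  ∷ (⋆ ∷ s0 ∷ ⋆ ∷ s1 ∷ ⋆ ∷ s1 ∷ s0 ∷ s1 ∷ [])
  ∷ (⋆ ∷ ⋆ ∷ s1 ∷ s1 ∷ s0 ∷ ⋆ ∷ s1 ∷ s1 ∷ [])
  ∷ (⋆ ∷ s0 ∷ s1 ∷ s0 ∷ s0 ∷ ⋆ ∷ ⋆ ∷ s1 ∷ [])
  ∷ (⋆ ∷ s1 ∷ s1 ∷ s0 ∷ ⋆ ∷ s0 ∷ ⋆ ∷ s1 ∷ [])
  ∷ (s1 ∷ ⋆ ∷ s1 ∷ s1 ∷ ⋆ ∷ s0 ∷ s0 ∷ ⋆ ∷ [])
  ∷ (s0 ∷ ⋆ ∷ ⋆ ∷ s1 ∷ s0 ∷ s0 ∷ s0 ∷ ⋆ ∷ [])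
  ∷ (⋆ ∷ ⋆ ∷ s0 ∷ ⋆ ∷ s0 ∷ s0 ∷ s1 ∷ s1 ∷ [])
  ∷ (s1 ∷ ⋆ ∷ s0 ∷ ⋆ ∷ s0 ∷ s0 ∷ s0 ∷ ⋆ ∷ [])
  ∷ (⋆ ∷ ⋆ ∷ s1 ∷ ⋆ ∷ s1 ∷ s1 ∷ s0 ∷ s0 ∷ [])
  ∷ (⋆ ∷ ⋆ ∷ s1 ∷ s0 ∷ ⋆ ∷ s0 ∷ s0 ∷ s0 ∷ [])
  ∷ (⋆ ∷ s1 ∷ s0 ∷ ⋆ ∷ s1 ∷ s0 ∷ ⋆ ∷ s1 ∷ [])
  ∷ (⋆ ∷ ⋆ ∷ s0 ∷ s0 ∷ s1 ∷ ⋆ ∷ s0 ∷ s0 ∷ [])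
  ∷ (⋆ ∷ s0 ∷ ⋆ ∷ s0 ∷ s1 ∷ s0 ∷ s1 ∷ ⋆ ∷ [])
  ∷ (⋆ ∷ s0 ∷ ⋆ ∷ s0 ∷ s1 ∷ ⋆ ∷ s0 ∷ s1 ∷ [])
  ∷ (⋆ ∷ s1 ∷ ⋆ ∷ ⋆ ∷ s1 ∷ s1 ∷ s0 ∷ s1 ∷ [])
  ∷ []

proposition3 : AntipodalSplitting 4 3 × AntipodalSplitting 8 5
proposition3 = fromFaces 3 faces₄₃ _ , fromFaces 5 faces₈₅ _
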